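{- For any $n>0$ and any graph $H$ with $|H|\notin\{n-1,n\}$, $$\mu(H,K_n)=\mu(H,\overline{K_n})=\mu(H,C_n)=0.$$
   Context: $\mathcal{G}$ is the poset of all finite unlabelled graphs (loops and multiple edges allowed), up to isomorphism, with $H\le G$ iff $H$ is isomorphic to an induced subgraph of $G$; $|H|$ is the number of vertices; $\mu$ is its Möbius function ($\mu(a,a)=1$, $\mu(a,b)=0$ if $a\not\le b$, $\mu(a,b)=-\sum_{a\le c<b}\mu(a,c)$ if $a<b$). $K_n$ is the complete graph, $\overline{K_n}$ the edgeless graph and $C_n$ the cycle graph on $n$ vertices. -}

module Defs where

open import Data.Nat as ℕ using (ℕ; zero; suc; _%_; _∸_)
open import Data.Nat.Properties as ℕP using (+-comm)
open import Data.Fin using (Fin; toℕ; _≟_)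
open import Data.Integer using (ℤ; _+_; -_) renaming (0ℤ to 0ℤ; 1ℤ to 1ℤ)
open import Data.List using (List; []; _∷_; map; foldr)
open import Data.List.Relation.Unary.All using (All)
open import Data.List.Relation.Unary.Any using (Any)
open import Data.List.Relation.Unary.AllPairs using (AllPairs)
open import Data.Product using (_×_; Σ; _,_)
open import Function.Bundles using (_⤖_; Bijection)
open import Function.Definitions using (Injective)
open import Relation.Binary.PropositionalEquality using (_≡_; refl; sym; _≢_)
open import Relation.Nullary using (¬_; does; yes; no)
open import Data.Empty using (⊥-elim)
open import Data.Bool using (if_then_else_; true; false)

-- Finite graphs with loops and multiple edges.
-- A graph on `size` vertices is a symmetric multiplicity matrix:
-- adj i j = number of edges between i and j (adj i i = number of loops).

record Graph : Set where
  constructor mkGraph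
  field
    size : ℕ
    adj  : Fin size → Fin size → ℕ
    adj-sym : ∀ i j → adj i j ≡ adj j i
open Graph public

∣_∣ᵍ : Graph → ℕ
∣ G ∣ᵍ = size G

-- Isomorphism: a bijection of vertex sets preserving edge multiplicities.
-- (Elements of the poset 𝒢 are isomorphism classes; we work with
-- representatives and this equivalence relation.)
_≅_ : Graph → Graph → Set
G ≅ H = Σ (Fin (size G) ⤖ Fin (size H)) λ f →
          ∀ i j → adj G i j ≡ adj H (Bijection.to f i) (Bijection.to f j)

_≤ᵍ_ : Graph → Graph → Set
H ≤ᵍ G = Σ (Fin (size H) → Fin (size G)) λ f →
           Injective _≡_ _≡_ f × (∀ i j → adj H i j ≡ adj G (f i) (f j))

_<ᵍ_ : Graph → Graph → Set
H <ᵍ G = H ≤ᵍ G × ¬ (H ≅ G)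

private
  kadj : ∀ {n} → Fin n → Fin n → ℕ
  kadj i j = if does (i ≟ j) then 0 else 1

  kadj-sym : ∀ {n} (i j : Fin n) → kadj i j ≡ kadj j i
  kadj-sym i j with i ≟ j | j ≟ i
  ... | yes _ | yes _ = refl
  ... | no _  | no _  = refl
  ... | yes p | no q  = ⊥-elim (q (sym p))
  ... | no p  | yes q = ⊥-elim (p (sym q))

K : ℕ → Graph
K n = mkGraph n kadj kadj-sym

Kbar : ℕ → Graph
Kbar n = mkGraph n (λ _ _ → 0) (λ _ _ → refl)

-- cycle C_n: vertex i is joined to i+1 mod n (one edge for each such
-- relation). For n ≥ 3 this is the usual simple cycle; C_0 is empty.
private
  step : ∀ k → Fin (suc k) → Fin (suc k) → ℕ
  step k i j = if does (toℕ j ℕ.≟ ((toℕ i ℕ.+ 1) % suc k)) then 1 else 0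

C : ℕ → Graph
C zero    = mkGraph zero (λ _ _ → 0) (λ _ _ → refl)
C (suc k) = mkGraph (suc k) (λ i j → step k i j ℕ.+ step k j i)
                           (λ i j → +-comm (step k i j) (step k j i))

sumℤ : List ℤ → ℤ
sumℤ = foldr _+_ 0ℤ

IsIntervalReps : Graph → Graph → List Graph → Set
IsIntervalReps a b L =
  All (λ c → a ≤ᵍ c × c <ᵍ b) L ×
  (∀ c → a ≤ᵍ c → c <ᵍ b → Any (c ≅_) L) ×
  AllPairs (λ x y → ¬ (x ≅ y)) L

-- m is the Möbius function of 𝒢 (well defined on isomorphism classes and
-- satisfying the defining recursion). Such a function exists and is unique.
record IsMobius (m : Graph → Graph → ℤ) : Set where
  field
    resp  : ∀ a a' b b' → a ≅ a' → b ≅ b' → m a b ≡ m a' b'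
    diag  : ∀ a → m a a ≡ 1ℤ
    notle : ∀ a b → ¬ (a ≤ᵍ b) → m a b ≡ 0ℤ
    rec   : ∀ a b → a <ᵍ b → ∀ L → IsIntervalReps a b L →
              m a b ≡ - sumℤ (map (m a) L)

{-# OPTIONS --safe #-}
-- K n, Kbar n and C n are invariant under the rotation i ↦ i + 1 (mod n), hence vertex-transitive,
-- so every proper induced subgraph of such a G embeds into G' = G minus a vertex: G' is the unique
-- coatom below G. If H ≰ G' then H ≰ G and μ(H,G) = 0. Otherwise [H,G) = [H,G') ∪ {G'}, so
-- μ(H,G) = -(μ(H,G') + Σ_{[H,G')} μ(H,·)) = -(μ(H,G') - μ(H,G')) = 0. The size conditions on H
-- only rule out H ≅ G and H ≅ G'.
module Submission where

open import Defs
open import Data.Bool.Base using (if_then_else_)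
open import Data.Fin.Base as Fin using (Fin; zero; suc; toℕ; punchIn; punchOut)
open import Data.Fin.Properties as Finₚ
  using (toℕ<n; toℕ-injective; toℕ-inject₁; toℕ-fromℕ; injective⇒≤; ¬∀⟶∃¬;
         punchIn-injective; punchOut-injective; punchIn-punchOut)
open import Data.Fin.Relation.Unary.Top using (view; ‵fromℕ; ‵inject₁)
open import Data.Integer.Base as ℤ using (ℤ; 0ℤ; -_)
open import Data.Integer.Properties using (+-inverseˡ)
open import Data.List.Base
  using (List; []; _∷_; map; concatMap; upTo; allFin; filter; deduplicate; cartesianProductWith)
open import Data.List.Membership.Propositional.Properties using (∈-allFin; ∈-upTo⁺)
open import Data.List.Membership.Propositional using (lose)
import Data.List.Membership.Setoid as SetoidMembership
open import Data.List.Membership.Setoid.Properties using (∈-filter⁺; ∈-deduplicate⁺)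
open import Data.List.Relation.Unary.All as All using (_∷_)
open import Data.List.Relation.Unary.All.Properties as Allₚ using (all-filter)
open import Data.List.Relation.Unary.AllPairs using (_∷_)
open import Data.List.Relation.Unary.Any as Any using (Any; here; there; any?)
open import Data.List.Relation.Unary.Any.Properties using (map⁺; concatMap⁺; cartesianProductWith⁺)
open import Data.List.Relation.Unary.Unique.DecSetoid.Properties using (deduplicate-!)
open import Data.Nat.Base as ℕ using (ℕ; zero; suc; _+_; _<_; _≤_; _∸_)
open import Data.Nat.DivMod using (_%_; %-distribˡ-+; m%n%n≡m%n; n%n≡0; [m+n]%n≡m%n; m<n⇒m%n≡m)
open import Data.Nat.Properties as ℕₚ using (m+[n∸m]≡n; <⇒≤)
open import Data.Product.Base using (Σ; ∃; _×_; _,_; proj₁; proj₂)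
open import Data.Vec.Functional using () renaming ([] to []ᶠ; _∷_ to _∷ᶠ_)
open import Function.Base using (id; _∘_)
open import Function.Bundles using (_⇔_; mk⤖; mk⇔; module Bijection; module Surjection)
open import Function.Construct.Composition using (_⤖-∘_; _⇔-∘_)
open import Function.Construct.Identity using (⤖-id)
open import Function.Construct.Symmetry using (⤖-sym; ⇔-sym)
open import Function.Definitions using (Injective; StrictlySurjective)
open import Function.Consequences.Propositional using (strictlySurjective⇒surjective)
open import Relation.Binary.Bundles using (Setoid; DecSetoid)
open import Relation.Binary.Definitions using (Decidable)
open import Relation.Binary.PropositionalEquality
  using (_≡_; _≢_; refl; sym; trans; cong; cong₂; _≗_; module ≡-Reasoning)
open import Relation.Nullary using (¬_; Dec; yes; no; does; contradiction)
open import Relation.Nullary.Decidable using (_×-dec_; _→-dec_; ¬?; map′; does-⇔)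

-- Graph arguments are often given explicitly: _≅_ and _≤ᵍ_ unfold to Σ-types from which
-- Agda cannot infer the graphs.

≅-refl : ∀ {G} → G ≅ G
≅-refl = ⤖-id _ , λ _ _ → refl

≅-sym : ∀ {G H} → G ≅ H → H ≅ G
≅-sym {G} {H} (f , f-pres) = ⤖-sym f , λ i j → sym (begin
  adj G (to⁻ i) (to⁻ j)            ≡⟨ f-pres (to⁻ i) (to⁻ j) ⟩
  adj H (to (to⁻ i)) (to (to⁻ j))  ≡⟨ cong₂ (adj H) (to∘to⁻ i) (to∘to⁻ j) ⟩
  adj H i j                        ∎)
  where open Surjection (Bijection.surjection f) using (to; to⁻; to∘to⁻); open ≡-Reasoning

≅-trans : ∀ {G H L} → G ≅ H → H ≅ L → G ≅ L
≅-trans (f , f-pres) (g , g-pres) = g ⤖-∘ f , λ i j → trans (f-pres i j) (g-pres _ _)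

≅-setoid : Setoid _ _
≅-setoid = record
  { Carrier = Graph
  ; _≈_ = _≅_
  ; isEquivalence = record
    { refl = λ {G} → ≅-refl {G}
    ; sym = λ {G H} → ≅-sym {G} {H}
    ; trans = λ {G H L} → ≅-trans {G} {H} {L}
    }
  }

≤ᵍ-trans : ∀ {A B G} → A ≤ᵍ B → B ≤ᵍ G → A ≤ᵍ G
≤ᵍ-trans (f , f-inj , f-pres) (g , g-inj , g-pres) =
  g ∘ f , f-inj ∘ g-inj , λ i j → trans (f-pres i j) (g-pres _ _)

≅⇒≤ᵍ : ∀ {A B} → A ≅ B → A ≤ᵍ B
≅⇒≤ᵍ (f , f-pres) = Bijection.to f , Bijection.injective f , f-pres

≤ᵍ⇒size≤ : ∀ {A B} → A ≤ᵍ B → size A ≤ size B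
≤ᵍ⇒size≤ (_ , f-inj , _) = injective⇒≤ f-inj

≅⇒size≡ : ∀ {A B} → A ≅ B → size A ≡ size B
≅⇒size≡ {A} {B} A≅B =
  ℕₚ.≤-antisym (≤ᵍ⇒size≤ {A} {B} (≅⇒≤ᵍ {A} {B} A≅B))
               (≤ᵍ⇒size≤ {B} {A} (≅⇒≤ᵍ {B} {A} (≅-sym {A} {B} A≅B)))

size≢⇒≇ : ∀ {A B} → size A ≢ size B → ¬ (A ≅ B)
size≢⇒≇ {A} {B} size≢ = size≢ ∘ ≅⇒size≡ {A} {B}

injective⇒strictlySurjective : ∀ {m n} {f : Fin m → Fin n} →
  Injective _≡_ _≡_ f → n ≤ m → StrictlySurjective _≡_ f
injective⇒strictlySurjective {n = suc n} {f} f-inj n<m y with Finₚ.any? (λ x → f x Finₚ.≟ y)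
... | yes hit = hit
... | no miss = contradiction (injective⇒≤ punchOut∘f-inj) (ℕₚ.<⇒≱ n<m)
  where
  y≢f : ∀ x → y ≢ f x
  y≢f x y≡fx = miss (x , sym y≡fx)
  punchOut∘f-inj : Injective _≡_ _≡_ (λ x → punchOut (y≢f x))
  punchOut∘f-inj = f-inj ∘ punchOut-injective (y≢f _) (y≢f _)

onto-embedding⇒≅ : ∀ {A B} ((f , _) : A ≤ᵍ B) → StrictlySurjective _≡_ f → A ≅ B
onto-embedding⇒≅ (f , f-inj , f-pres) f-onto =
  mk⤖ (f-inj , strictlySurjective⇒surjective f-onto) , f-pres

≤ᵍ⇒≅ : ∀ {A B} → A ≤ᵍ B → size B ≤ size A → A ≅ B
≤ᵍ⇒≅ {A} {B} A≤B@(_ , f-inj , _) B≤A =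
  onto-embedding⇒≅ {A} {B} A≤B (injective⇒strictlySurjective f-inj B≤A)

<ᵍ⇒size< : ∀ {A B} → A <ᵍ B → size A < size B
<ᵍ⇒size< {A} {B} (A≤B , A≇B) with size A ℕₚ.<? size B
... | yes A<B = A<B
... | no A≮B = contradiction (≤ᵍ⇒≅ {A} {B} A≤B (ℕₚ.≮⇒≥ A≮B)) A≇B

≤ᵍ-<ᵍ-trans : ∀ {A B G} → A ≤ᵍ B → B <ᵍ G → A <ᵍ G
≤ᵍ-<ᵍ-trans {A} {B} {G} A≤B B<G@(B≤G , _) =
  ≤ᵍ-trans {A} {B} {G} A≤B B≤G ,
  size≢⇒≇ {A} {G} (ℕₚ.<⇒≢ (ℕₚ.≤-<-trans (≤ᵍ⇒size≤ {A} {B} A≤B) (<ᵍ⇒size< {B} {G} B<G)))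

-- Deciding embeddability and isomorphism

allFunctions : ∀ k n → List (Fin k → Fin n)
allFunctions zero    n = []ᶠ ∷ []
allFunctions (suc k) n = cartesianProductWith _∷ᶠ_ (allFin n) (allFunctions k n)

allFunctions-complete : ∀ {k n} (f : Fin k → Fin n) → Any (_≗ f) (allFunctions k n)
allFunctions-complete {zero}  f = here λ ()
allFunctions-complete {suc k} f =
  cartesianProductWith⁺ _∷ᶠ_ cons-≗ (∈-allFin (f zero)) (allFunctions-complete (f ∘ suc))
  where
  cons-≗ : ∀ {x g} → f zero ≡ x → g ≗ f ∘ suc → (x ∷ᶠ g) ≗ f
  cons-≗ f0≡x g≗ zero    = sym f0≡x
  cons-≗ f0≡x g≗ (suc i) = g≗ i

any-function? : ∀ {k n} {P : (Fin k → Fin n) → Set} →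
  (∀ {f g} → f ≗ g → P f → P g) → (∀ f → Dec (P f)) → Dec (∃ P)
any-function? {k} {n} resp P? = map′ Any.satisfied
  (λ (f , Pf) → Any.map (λ g≗f → resp (sym ∘ g≗f) Pf) (allFunctions-complete f))
  (any? P? (allFunctions k n))

_≤ᵍ?_ : ∀ A B → Dec (A ≤ᵍ B)
A ≤ᵍ? B = any-function? resp (λ f → injective? f ×-dec preserves? f)
  where
  injective? : (f : Fin (size A) → Fin (size B)) → Dec (Injective _≡_ _≡_ f)
  injective? f = map′ (λ inj {x} {y} → inj x y) (λ inj x y → inj)
    (Finₚ.all? λ x → Finₚ.all? λ y → (f x Finₚ.≟ f y) →-dec (x Finₚ.≟ y))
  preserves? : (f : Fin (size A) → Fin (size B)) → Dec (∀ i j → adj A i j ≡ adj B (f i) (f j))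
  preserves? f = Finₚ.all? λ i → Finₚ.all? λ j → adj A i j ℕₚ.≟ adj B (f i) (f j)
  resp : ∀ {f g} → f ≗ g →
    Injective _≡_ _≡_ f × (∀ i j → adj A i j ≡ adj B (f i) (f j)) →
    Injective _≡_ _≡_ g × (∀ i j → adj A i j ≡ adj B (g i) (g j))
  resp f≗g (f-inj , f-pres) =
    (λ {x} {y} gx≡gy → f-inj (trans (f≗g x) (trans gx≡gy (sym (f≗g y))))) ,
    (λ i j → trans (f-pres i j) (cong₂ (adj B) (f≗g i) (f≗g j)))

_≅?_ : Decidable _≅_
A ≅? B = map′ (λ (A≤B , B≤A) → ≤ᵍ⇒≅ {A} {B} A≤B B≤A)
              (λ A≅B → ≅⇒≤ᵍ {A} {B} A≅B , ℕₚ.≤-reflexive (sym (≅⇒size≡ {A} {B} A≅B)))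
              ((A ≤ᵍ? B) ×-dec (size B ℕₚ.≤? size A))

≅-decSetoid : DecSetoid _ _
≅-decSetoid = record
  { isDecEquivalence = record { isEquivalence = Setoid.isEquivalence ≅-setoid ; _≟_ = _≅?_ } }

open SetoidMembership ≅-setoid using () renaming (_∈_ to _∈≅_)

inducedSubgraph : ∀ (B : Graph) {k} → (Fin k → Fin (size B)) → Graph
inducedSubgraph B {k} f = mkGraph k (λ i j → adj B (f i) (f j)) (λ i j → adj-sym B (f i) (f j))

inducedSubgraphsOfSize : Graph → ℕ → List Graph
inducedSubgraphsOfSize B k = map (inducedSubgraph B) (allFunctions k (size B))

inducedSubgraphs : Graph → List Graph
inducedSubgraphs B = concatMap (inducedSubgraphsOfSize B) (upTo (suc (size B)))

inducedSubgraphs-complete : ∀ {A B} → A ≤ᵍ B → A ∈≅ inducedSubgraphs B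
inducedSubgraphs-complete {A} {B} A≤B@(f , _ , f-pres) =
  concatMap⁺ (inducedSubgraphsOfSize B)
    (lose (∈-upTo⁺ (ℕ.s≤s (≤ᵍ⇒size≤ {A} {B} A≤B))) (map⁺ (Any.map ≅-induced (allFunctions-complete f))))
  where
  ≅-induced : ∀ {g} → g ≗ f → A ≅ inducedSubgraph B g
  ≅-induced g≗f = ⤖-id _ , λ i j → trans (f-pres i j) (sym (cong₂ (adj B) (g≗f i) (g≗f j)))

module _ (A B : Graph) where

  InInterval : Graph → Set
  InInterval G = A ≤ᵍ G × G <ᵍ B

  inInterval? : ∀ G → Dec (InInterval G)
  inInterval? G = (A ≤ᵍ? G) ×-dec ((G ≤ᵍ? B) ×-dec ¬? (G ≅? B))

  inInterval-resp : ∀ {G G'} → G ≅ G' → InInterval G → InInterval G'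
  inInterval-resp {G} {G'} G≅G' (A≤G , G≤B , G≇B) =
    ≤ᵍ-trans {A} {G} {G'} A≤G (≅⇒≤ᵍ {G} {G'} G≅G') ,
    ≤ᵍ-trans {G'} {G} {B} (≅⇒≤ᵍ {G'} {G} (≅-sym {G} {G'} G≅G')) G≤B ,
    G≇B ∘ ≅-trans {G} {G'} {B} G≅G'

  intervalReps : Σ (List Graph) (IsIntervalReps A B)
  intervalReps = reps , Allₚ.deduplicate⁺ _≅?_ (all-filter inInterval? candidates) , complete ,
    deduplicate-! ≅-decSetoid (filter inInterval? candidates)
    where
    candidates = inducedSubgraphs B
    reps = deduplicate _≅?_ (filter inInterval? candidates)

    ≅-resp-flip : ∀ {G H L} → L ≅ H → G ≅ H → G ≅ L
    ≅-resp-flip {G} {H} {L} L≅H G≅H = ≅-trans {G} {H} {L} G≅H (≅-sym {L} {H} L≅H)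

    complete : ∀ G → A ≤ᵍ G → G <ᵍ B → G ∈≅ reps
    complete G A≤G G<B = ∈-deduplicate⁺ ≅-setoid _≅?_ (λ {G} {H} {L} → ≅-resp-flip {G} {H} {L}) {z = G}
      (∈-filter⁺ ≅-setoid inInterval? (λ {G} {G'} → inInterval-resp {G} {G'}) {G}
        (inducedSubgraphs-complete {G} {B} (proj₁ G<B)) (A≤G , G<B))

IsUniqueCoatom : Graph → Graph → Set
IsUniqueCoatom G' G = G' <ᵍ G × (∀ A → A <ᵍ G → A ≤ᵍ G')

uniqueCoatom-intervalReps : ∀ {H G' G L} → IsUniqueCoatom G' G → H ≤ᵍ G' →
  IsIntervalReps H G' L → IsIntervalReps H G (G' ∷ L)
uniqueCoatom-intervalReps {H} {G'} {G} {L} (G'<G , below-G') H≤G' (L-in , L-complete , L-distinct) =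
  (H≤G' , G'<G) ∷ All.map (λ {A} (H≤A , A<G') → H≤A , ≤ᵍ-<ᵍ-trans {A} {G'} {G} (proj₁ A<G') G'<G) L-in ,
  complete ,
  All.map (λ {A} (_ , _ , A≇G') G'≅A → A≇G' (≅-sym {G'} {A} G'≅A)) L-in ∷ L-distinct
  where
  complete : ∀ A → H ≤ᵍ A → A <ᵍ G → A ∈≅ (G' ∷ L)
  complete A H≤A A<G with A ≅? G'
  ... | yes A≅G' = here A≅G'
  ... | no A≇G'  = there (L-complete A H≤A (below-G' A A<G , A≇G'))

module _ (μ : Graph → Graph → ℤ) (isMobius : IsMobius μ) where
  open IsMobius isMobius

  uniqueCoatom⇒μ≡0 : ∀ {H G' G} → IsUniqueCoatom G' G → ¬ (H ≅ G) → ¬ (H ≅ G') → μ H G ≡ 0ℤ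
  uniqueCoatom⇒μ≡0 {H} {G'} {G} coatom@(G'<G , below-G') H≇G H≇G' with H ≤ᵍ? G'
  ... | no H≰G' = notle H G (λ H≤G → H≰G' (below-G' H (H≤G , H≇G)))
  ... | yes H≤G' = begin
    μ H G             ≡⟨ rec H G H<G (G' ∷ L) (uniqueCoatom-intervalReps {H} {G'} {G} {L} coatom H≤G' L-reps) ⟩
    - (μ H G' ℤ.+ s)  ≡⟨ cong (λ x → - (x ℤ.+ s)) (rec H G' (H≤G' , H≇G') L L-reps) ⟩
    - (- s ℤ.+ s)     ≡⟨ cong -_ (+-inverseˡ s) ⟩
    0ℤ                ∎
    where
    open ≡-Reasoning
    H<G = ≤ᵍ-trans {H} {G'} {G} H≤G' (proj₁ G'<G) , H≇G
    L = proj₁ (intervalReps H G')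
    L-reps = proj₂ (intervalReps H G')
    s = sumℤ (map (μ H) L)

-- Vertex-transitive graphs

_─_ : (G : Graph) → Fin (size G) → Graph
mkGraph (suc n) a a-sym ─ v =
  mkGraph n (λ i j → a (punchIn v i) (punchIn v j)) (λ i j → a-sym (punchIn v i) (punchIn v j))

─-size : ∀ G v → suc (size (G ─ v)) ≡ size G
─-size (mkGraph (suc n) _ _) v = refl

─-<ᵍ : ∀ G v → (G ─ v) <ᵍ G
─-<ᵍ G@(mkGraph (suc n) _ _) v =
  (punchIn v , punchIn-injective v _ _ , λ _ _ → refl) , size≢⇒≇ {G ─ v} {G} (ℕₚ.<⇒≢ (ℕₚ.n<1+n n))

avoiding-embedding⇒≤ᵍ─ : ∀ {A} G v ((f , _) : A ≤ᵍ G) → (∀ x → v ≢ f x) → A ≤ᵍ (G ─ v)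
avoiding-embedding⇒≤ᵍ─ (mkGraph (suc n) a a-sym) v (f , f-inj , f-pres) v≢f =
  (λ x → punchOut (v≢f x)) ,
  f-inj ∘ punchOut-injective (v≢f _) (v≢f _) ,
  λ i j → trans (f-pres i j) (sym (cong₂ a (punchIn-punchOut (v≢f i)) (punchIn-punchOut (v≢f j))))

IsVertexTransitive : Graph → Set
IsVertexTransitive G = ∀ u v → Σ (G ≤ᵍ G) λ (σ , _) → σ u ≡ v

vertexTransitive⇒uniqueCoatom : ∀ G v → IsVertexTransitive G → IsUniqueCoatom (G ─ v) G
vertexTransitive⇒uniqueCoatom G v transitive = ─-<ᵍ G v , below-G─v
  where
  -- A proper embedding f misses some vertex w; an automorphism taking w to v makes σ ∘ f miss v.
  below-G─v : ∀ A → A <ᵍ G → A ≤ᵍ (G ─ v)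
  below-G─v A (A≤G@(f , _) , A≇G)
    with w , w∉f ← ¬∀⟶∃¬ _ _ (λ w → Finₚ.any? λ x → f x Finₚ.≟ w) (A≇G ∘ onto-embedding⇒≅ {A} {G} A≤G)
    with σ@(s , s-inj , _) , sw≡v ← transitive w v
    = avoiding-embedding⇒≤ᵍ─ {A} G v (≤ᵍ-trans {A} {G} {G} A≤G σ)
        λ x v≡sfx → w∉f (x , s-inj (trans (sym v≡sfx) (sym sw≡v)))

module _ (μ : Graph → Graph → ℤ) (isMobius : IsMobius μ) where

  vertexTransitive⇒μ≡0 : ∀ {H} G → 0 < size G → IsVertexTransitive G →
    size H ≢ size G → suc (size H) ≢ size G → μ H G ≡ 0ℤ
  vertexTransitive⇒μ≡0 {H} G 0<|G| transitive |H|≢|G| 1+|H|≢|G| =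
    uniqueCoatom⇒μ≡0 μ isMobius {H} {G ─ v} {G}
      (vertexTransitive⇒uniqueCoatom G v transitive)
      (size≢⇒≇ {H} {G} |H|≢|G|)
      (size≢⇒≇ {H} {G ─ v} (λ |H|≡ → 1+|H|≢|G| (trans (cong suc |H|≡) (─-size G v))))
    where
    v = Fin.fromℕ< 0<|G|

-- Rotations

rotate : ∀ {n} → Fin n → Fin n
rotate {suc n} i with view i
... | ‵fromℕ      = zero
... | ‵inject₁ j = suc j

rotate-injective : ∀ {n} → Injective _≡_ _≡_ (rotate {n})
rotate-injective {suc n} {i} {j} ri≡rj with view i | view j
... | ‵fromℕ      | ‵fromℕ      = refl
... | ‵inject₁ _  | ‵inject₁ _  = cong Fin.inject₁ (Finₚ.suc-injective ri≡rj)
... | ‵fromℕ      | ‵inject₁ _  = contradiction ri≡rj λ ()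
... | ‵inject₁ _  | ‵fromℕ      = contradiction ri≡rj λ ()

rotate-≡⇔ : ∀ {n} {i j : Fin n} → rotate i ≡ rotate j ⇔ i ≡ j
rotate-≡⇔ = mk⇔ rotate-injective (cong rotate)

toℕ-rotate : ∀ {n} (i : Fin (suc n)) → toℕ (rotate i) ≡ (toℕ i + 1) % suc n
toℕ-rotate {n} i with view i
... | ‵fromℕ = sym (begin
  (toℕ (Fin.fromℕ n) + 1) % suc n  ≡⟨ cong (λ x → (x + 1) % suc n) (toℕ-fromℕ n) ⟩
  (n + 1) % suc n                  ≡⟨ cong (_% suc n) (ℕₚ.+-comm n 1) ⟩
  suc n % suc n                    ≡⟨ n%n≡0 (suc n) ⟩
  0                                ∎)
  where open ≡-Reasoning
... | ‵inject₁ j = sym (begin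
  (toℕ (Fin.inject₁ j) + 1) % suc n  ≡⟨ cong (λ x → (x + 1) % suc n) (toℕ-inject₁ j) ⟩
  (toℕ j + 1) % suc n                ≡⟨ cong (_% suc n) (ℕₚ.+-comm (toℕ j) 1) ⟩
  suc (toℕ j) % suc n                ≡⟨ m<n⇒m%n≡m (ℕ.s≤s (toℕ<n j)) ⟩
  suc (toℕ j)                        ∎)
  where open ≡-Reasoning

rotateBy : ∀ {n} → ℕ → Fin n → Fin n
rotateBy zero    i = i
rotateBy (suc t) i = rotate (rotateBy t i)

[m%n+k]%n≡[m+k]%n : ∀ m k n .{{_ : ℕ.NonZero n}} → (m % n + k) % n ≡ (m + k) % n
[m%n+k]%n≡[m+k]%n m k n = begin
  (m % n + k) % n          ≡⟨ %-distribˡ-+ (m % n) k n ⟩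
  (m % n % n + k % n) % n  ≡⟨ cong (λ x → (x + k % n) % n) (m%n%n≡m%n m n) ⟩
  (m % n + k % n) % n      ≡⟨ %-distribˡ-+ m k n ⟨
  (m + k) % n              ∎
  where open ≡-Reasoning

toℕ-rotateBy : ∀ {n} t (i : Fin (suc n)) → toℕ (rotateBy t i) ≡ (toℕ i + t) % suc n
toℕ-rotateBy {n} zero i = sym (begin
  (toℕ i + 0) % suc n  ≡⟨ cong (_% suc n) (ℕₚ.+-identityʳ (toℕ i)) ⟩
  toℕ i % suc n        ≡⟨ m<n⇒m%n≡m (toℕ<n i) ⟩
  toℕ i                ∎)
  where open ≡-Reasoning
toℕ-rotateBy {n} (suc t) i = begin
  toℕ (rotate (rotateBy t i))        ≡⟨ toℕ-rotate (rotateBy t i) ⟩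
  (toℕ (rotateBy t i) + 1) % suc n   ≡⟨ cong (λ x → (x + 1) % suc n) (toℕ-rotateBy t i) ⟩
  ((toℕ i + t) % suc n + 1) % suc n  ≡⟨ [m%n+k]%n≡[m+k]%n (toℕ i + t) 1 (suc n) ⟩
  (toℕ i + t + 1) % suc n            ≡⟨ cong (_% suc n) (ℕₚ.+-assoc (toℕ i) t 1) ⟩
  (toℕ i + (t + 1)) % suc n          ≡⟨ cong (λ x → (toℕ i + x) % suc n) (ℕₚ.+-comm t 1) ⟩
  (toℕ i + suc t) % suc n            ∎
  where open ≡-Reasoning

rotateBy-transitive : ∀ {n} (u v : Fin n) → ∃ λ t → rotateBy t u ≡ v
rotateBy-transitive {suc n} u v = t , toℕ-injective (begin
  toℕ (rotateBy t u)                         ≡⟨ toℕ-rotateBy t u ⟩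
  (toℕ u + (suc n ∸ toℕ u + toℕ v)) % suc n  ≡⟨ cong (_% suc n) (ℕₚ.+-assoc (toℕ u) _ (toℕ v)) ⟨
  (toℕ u + (suc n ∸ toℕ u) + toℕ v) % suc n  ≡⟨ cong (λ x → (x + toℕ v) % suc n) (m+[n∸m]≡n (<⇒≤ (toℕ<n u))) ⟩
  (suc n + toℕ v) % suc n                    ≡⟨ cong (_% suc n) (ℕₚ.+-comm (suc n) (toℕ v)) ⟩
  (toℕ v + suc n) % suc n                    ≡⟨ [m+n]%n≡m%n (toℕ v) (suc n) ⟩
  toℕ v % suc n                              ≡⟨ m<n⇒m%n≡m (toℕ<n v) ⟩
  toℕ v                                      ∎)
  where
  open ≡-Reasoning
  t = suc n ∸ toℕ u + toℕ v

RotationInvariant : Graph → Set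
RotationInvariant G = ∀ i j → adj G (rotate i) (rotate j) ≡ adj G i j

rotateBy-≤ᵍ : ∀ {G} → RotationInvariant G → ℕ → G ≤ᵍ G
rotateBy-≤ᵍ {G} invariant t = rotateBy t , injective t , preserves t
  where
  injective : ∀ t → Injective _≡_ _≡_ (rotateBy t)
  injective zero    = id
  injective (suc t) = injective t ∘ rotate-injective
  preserves : ∀ t i j → adj G i j ≡ adj G (rotateBy t i) (rotateBy t j)
  preserves zero    i j = refl
  preserves (suc t) i j = trans (preserves t i j) (sym (invariant _ _))

rotationInvariant⇒vertexTransitive : ∀ {G} → RotationInvariant G → IsVertexTransitive G
rotationInvariant⇒vertexTransitive {G} invariant u v with t , rotated ← rotateBy-transitive u v =
  rotateBy-≤ᵍ {G} invariant t , rotated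

K-rotationInvariant : ∀ n → RotationInvariant (K n)
K-rotationInvariant n i j =
  cong (λ b → if b then 0 else 1) (does-⇔ rotate-≡⇔ (rotate i Finₚ.≟ rotate j) (i Finₚ.≟ j))

Kbar-rotationInvariant : ∀ n → RotationInvariant (Kbar n)
Kbar-rotationInvariant n i j = refl

successor⇔≡rotate : ∀ {n} (i j : Fin (suc n)) → toℕ j ≡ (toℕ i + 1) % suc n ⇔ j ≡ rotate i
successor⇔≡rotate i j = mk⇔ (λ j≡i+1 → toℕ-injective (trans j≡i+1 (sym (toℕ-rotate i))))
                             (λ j≡ri → trans (cong toℕ j≡ri) (toℕ-rotate i))

C-rotationInvariant : ∀ n → RotationInvariant (C n)
C-rotationInvariant (suc n) i j =
  cong₂ (λ b b′ → (if b then 1 else 0) + (if b′ then 1 else 0)) (successor-invariant i j) (successor-invariant j i)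
  where
  successor-invariant : ∀ (i j : Fin (suc n)) →
    does (toℕ (rotate j) ℕₚ.≟ (toℕ (rotate i) + 1) % suc n) ≡ does (toℕ j ℕₚ.≟ (toℕ i + 1) % suc n)
  successor-invariant i j = does-⇔
    (⇔-sym (successor⇔≡rotate i j) ⇔-∘ (rotate-≡⇔ ⇔-∘ successor⇔≡rotate (rotate i) (rotate j)))
    (toℕ (rotate j) ℕₚ.≟ (toℕ (rotate i) + 1) % suc n) (toℕ j ℕₚ.≟ (toℕ i + 1) % suc n)

lemma3p6 : (μ : Graph → Graph → ℤ) → IsMobius μ →
    ∀ (n : ℕ) → 0 < n → ∀ (H : Graph) → ∣ H ∣ᵍ ≢ n ∸ 1 → ∣ H ∣ᵍ ≢ n →
    (μ H (K n) ≡ 0ℤ) × (μ H (Kbar n) ≡ 0ℤ) × (μ H (C n) ≡ 0ℤ)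
lemma3p6 μ isMobius (suc m) 0<n H |H|≢m |H|≢1+m =
  vanishes (K (suc m)) refl (K-rotationInvariant (suc m)) ,
  vanishes (Kbar (suc m)) refl (Kbar-rotationInvariant (suc m)) ,
  vanishes (C (suc m)) refl (C-rotationInvariant (suc m))
  where
  vanishes : ∀ G → size G ≡ suc m → RotationInvariant G → μ H G ≡ 0ℤ
  vanishes G refl invariant = vertexTransitive⇒μ≡0 μ isMobius G 0<n
    (rotationInvariant⇒vertexTransitive {G} invariant) |H|≢1+m (|H|≢m ∘ ℕₚ.suc-injective)
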